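{- Let $G$ be a connected finite simple graph with vertex set $\{1,\dots,p\}$ and $q$ edges, and let $\mathcal{P}_G$ be its graphicahedron. For each $i=1,\dots,q-1$, given an $(i-1)$-face $(K,\alpha)$ and an $(i+1)$-face $(L,\beta)$ of $\mathcal{P}_G$ with $(K,\alpha)\le(L,\beta)$, there are exactly two $i$-faces $(J,\gamma)$ with $(K,\alpha)\le(J,\gamma)\le(L,\beta)$. Moreover, given a $1$-face $(L,\beta)$ of $\mathcal{P}_G$, there are exactly two $0$-faces $(J,\gamma)$ with $(J,\gamma)\le(L,\beta)$.
   Context: For an edge $e=\{i,j\}$ of $G$ let $\tau_e=(i\;j)\in S_p$, and for $K\subseteq E(G)$ let $T_K=\langle \tau_e : e\in K\rangle$ (trivial if $K=\emptyset$). The graphicahedron $\mathcal{P}_G$ is the poset of pairs $(K,\alpha)$, $K\subseteq E(G)$, $\alpha\in S_p$, modulo $(K,\alpha)\sim(L,\beta)$ iff $K=L$ and $T_K\alpha=T_L\beta$, ordered by $(K,\alpha)\le(L,\beta)$ iff $K\subseteq L$ and $T_K\alpha\subseteq T_L\beta$; the face $(K,\alpha)$ has rank $|K|$ and is called an $|K|$-face. -}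

module Defs where

open import Data.Nat using (ℕ)
open import Data.Fin using (Fin)
open import Data.Fin.Subset using (Subset; _∈_; _⊆_; ∣_∣)
open import Data.Fin.Permutation using (Permutation′; _⟨$⟩ʳ_; _≈_; id; flip; _∘ₚ_; transpose)
open import Data.Product using (Σ; _×_; _,_; proj₁; proj₂; ∃)
open import Data.Sum using (_⊎_)
open import Relation.Binary.PropositionalEquality using (_≡_; _≢_)
open import Relation.Nullary using (¬_)
open import Function.Bundles using (_⇔_)

record Graph (p q : ℕ) : Set where
  field
    ends     : Fin q → Fin p × Fin p
    loopless : ∀ e → proj₁ (ends e) ≢ proj₂ (ends e)
    simple   : ∀ e f →
               (ends e ≡ ends f ⊎ (proj₁ (ends e) ≡ proj₂ (ends f) × proj₂ (ends e) ≡ proj₁ (ends f)))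
               → e ≡ f
open Graph public

module _ {p q : ℕ} (G : Graph p q) where

  Adjacent : Fin p → Fin p → Set
  Adjacent u v = ∃ λ e → (ends G e ≡ (u , v)) ⊎ (ends G e ≡ (v , u))

  data Reach (u : Fin p) : Fin p → Set where
    here  : Reach u u
    there : ∀ {v w} → Reach u v → Adjacent v w → Reach u w

  Connected : Set
  Connected = ∀ u v → Reach u v

  τ : Fin q → Permutation′ p
  τ e = transpose (proj₁ (ends G e)) (proj₂ (ends G e))

  data InT (K : Subset q) : Permutation′ p → Set where
    gen  : ∀ {σ} e → e ∈ K → σ ≈ τ e → InT K σ
    one  : ∀ {σ} → σ ≈ id → InT K σ
    mul  : ∀ {σ ρ π} → InT K σ → InT K ρ → π ≈ (σ ∘ₚ ρ) → InT K π
    inv  : ∀ {σ π} → InT K σ → π ≈ flip σ → InT K π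

  InCoset : Subset q → Permutation′ p → Permutation′ p → Set
  InCoset K α σ = Σ (Permutation′ p) λ t → InT K t × σ ≈ (t ∘ₚ α)

  Face : Set
  Face = Subset q × Permutation′ p

  rank : Face → ℕ
  rank (K , _) = ∣ K ∣

  _∼_ : Face → Face → Set
  (K , α) ∼ (L , β) = (K ≡ L) × (∀ σ → InCoset K α σ ⇔ InCoset L β σ)

  _≤F_ : Face → Face → Set
  (K , α) ≤F (L , β) = (K ⊆ L) × (∀ σ → InCoset K α σ → InCoset L β σ)

  ExactlyTwo : (Face → Set) → Set
  ExactlyTwo P = Σ Face λ x → Σ Face λ y →
    P x × P y × ¬ (x ∼ y) × (∀ z → P z → (z ∼ x) ⊎ (z ∼ y))

-- If (K, α) ≤ (L, β) then α ∈ T_L β, so every face (J, γ) between them contains α and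
-- equals (J, α) for some K ⊆ J ⊆ L.  When ∣ L ∣ = ∣ K ∣ + 2 there are exactly two such J of
-- the middle size, K ∪ {e} and L ∖ {e} for any e ∈ L ∖ K.  An edge (⁅ e ⁆, β) is the coset
-- {β, τ_e β} of T_⁅e⁆ = {id, τ_e}, so its vertices are (∅, β) and (∅, τ_e β), which are
-- distinct because τ_e moves the endpoints of e.
module Submission where

open import Defs
open import Data.Nat using (ℕ; suc; _≤_; _<_; s≤s)
open import Data.Nat.Properties using (<-irrefl; ≤-trans; ≤-reflexive; n≤1+n; suc-injective)
open import Data.Fin using (Fin; _≟_) renaming (zero to fzero; suc to fsuc)
open import Data.Fin.Subset
  using (Subset; inside; outside; _∈_; _∉_; _⊆_; _⊂_; ∣_∣; ⁅_⁆; _∪_; _-_) renaming (⊥ to ∅)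
open import Data.Fin.Subset.Properties
  using ( _∈?_; drop-∷-⊆; s⊂s; out⊂; out⊂in; p⊆q⇒∣p∣≤∣q∣; ⊆-min; ∉⊥; ∣⊥∣≡0; ∣⁅x⁆∣≡1
        ; x∈⁅x⁆; x∈⁅y⁆⇒x≡y; ∪-identityʳ; p─⊥≡p; x∈p∪q⁻; x∈p∪q⁺; p⊆p∪q; p─q⊆p; x∈p∧x≢y⇒x∈p-y)
import Data.Fin.Permutation.Components as PC
open import Data.Fin.Permutation
  using (Permutation′; _⟨$⟩ʳ_; _⟨$⟩ˡ_; _≈_; id; flip; _∘ₚ_; inverseˡ; inverseʳ)
open import Data.Vec using ([]; _∷_; here; there)
open import Data.Product using (_×_; _,_; proj₁; proj₂; ∃)
open import Data.Sum using (_⊎_; inj₁; inj₂)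
import Data.Sum as Sum
open import Function using (_∘_)
open import Function.Bundles using (Injection; mk⇔; Equivalence)
open import Function.Properties.Inverse using (↔⇒↣)
open import Relation.Binary.PropositionalEquality using (_≡_; _≢_; refl; sym; trans; cong; subst)
open import Relation.Nullary using (Dec; yes; no; ¬_; contradiction)
open import Relation.Nullary.Decidable using (dec-true; dec-false)

transpose-matchˡ : ∀ {n} (i j : Fin n) → PC.transpose i j i ≡ j
transpose-matchˡ i j rewrite dec-true (i ≟ i) refl = refl

transpose-matchʳ : ∀ {n} (i j : Fin n) → PC.transpose i j j ≡ i
transpose-matchʳ i j with j ≟ i
... | yes j≡i = j≡i
... | no  _   rewrite dec-true (j ≟ j) refl = refl

transpose-mismatch : ∀ {n} {i j k : Fin n} → k ≢ i → k ≢ j → PC.transpose i j k ≡ k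
transpose-mismatch {i = i} {j} {k} k≢i k≢j
  rewrite dec-false (k ≟ i) k≢i | dec-false (k ≟ j) k≢j = refl

transpose-comm : ∀ {n} (i j k : Fin n) → PC.transpose i j k ≡ PC.transpose j i k
transpose-comm i j k = by-cases (k ≟ i) (k ≟ j)
  where
  by-cases : Dec (k ≡ i) → Dec (k ≡ j) → PC.transpose i j k ≡ PC.transpose j i k
  by-cases (yes refl) _          = trans (transpose-matchˡ k j) (sym (transpose-matchʳ j k))
  by-cases (no _)     (yes refl) = trans (transpose-matchʳ i k) (sym (transpose-matchˡ k i))
  by-cases (no k≢i)   (no k≢j)   =
    trans (transpose-mismatch k≢i k≢j) (sym (transpose-mismatch k≢j k≢i))

transpose-involutive : ∀ {n} (i j k : Fin n) → PC.transpose i j (PC.transpose i j k) ≡ k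
transpose-involutive i j k =
  trans (cong (PC.transpose i j) (transpose-comm i j k)) (PC.transpose-inverse i j)

flip-cong : ∀ {n} {σ ρ : Permutation′ n} → σ ≈ ρ → flip σ ≈ flip ρ
flip-cong {σ = σ} {ρ} σ≈ρ i =
  trans (sym (inverseˡ ρ)) (cong (ρ ⟨$⟩ˡ_) (trans (sym (σ≈ρ _)) (inverseʳ σ)))

p⊆q∧∣q∣≤∣p∣⇒p≡q : ∀ {n} {p q : Subset n} → p ⊆ q → ∣ q ∣ ≤ ∣ p ∣ → p ≡ q
p⊆q∧∣q∣≤∣p∣⇒p≡q {p = []}          {[]}          _   _ = refl
p⊆q∧∣q∣≤∣p∣⇒p≡q {p = inside  ∷ p} {inside  ∷ q} p⊆q (s≤s ∣q∣≤∣p∣) =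
  cong (inside ∷_) (p⊆q∧∣q∣≤∣p∣⇒p≡q (drop-∷-⊆ p⊆q) ∣q∣≤∣p∣)
p⊆q∧∣q∣≤∣p∣⇒p≡q {p = outside ∷ p} {outside ∷ q} p⊆q ∣q∣≤∣p∣ =
  cong (outside ∷_) (p⊆q∧∣q∣≤∣p∣⇒p≡q (drop-∷-⊆ p⊆q) ∣q∣≤∣p∣)
p⊆q∧∣q∣≤∣p∣⇒p≡q {p = inside  ∷ p} {outside ∷ q} p⊆q _ with p⊆q here
... | ()
p⊆q∧∣q∣≤∣p∣⇒p≡q {p = outside ∷ p} {inside  ∷ q} p⊆q ∣q∣≤∣p∣ =
  contradiction (≤-trans ∣q∣≤∣p∣ (p⊆q⇒∣p∣≤∣q∣ (drop-∷-⊆ p⊆q))) (<-irrefl refl)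

p⊆q∧∣p∣<∣q∣⇒p⊂q : ∀ {n} {p q : Subset n} → p ⊆ q → ∣ p ∣ < ∣ q ∣ → p ⊂ q
p⊆q∧∣p∣<∣q∣⇒p⊂q {p = inside  ∷ p} {inside  ∷ q} p⊆q (s≤s ∣p∣<∣q∣) =
  s⊂s (p⊆q∧∣p∣<∣q∣⇒p⊂q (drop-∷-⊆ p⊆q) ∣p∣<∣q∣)
p⊆q∧∣p∣<∣q∣⇒p⊂q {p = outside ∷ p} {outside ∷ q} p⊆q ∣p∣<∣q∣ =
  out⊂ (p⊆q∧∣p∣<∣q∣⇒p⊂q (drop-∷-⊆ p⊆q) ∣p∣<∣q∣)
p⊆q∧∣p∣<∣q∣⇒p⊂q {p = inside  ∷ p} {outside ∷ q} p⊆q _ with p⊆q here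
... | ()
p⊆q∧∣p∣<∣q∣⇒p⊂q {p = outside ∷ p} {inside  ∷ q} p⊆q _ = out⊂in (drop-∷-⊆ p⊆q)

∣p∣≡0⇒p≡∅ : ∀ {n} {p : Subset n} → ∣ p ∣ ≡ 0 → p ≡ ∅
∣p∣≡0⇒p≡∅ {n} {p} ∣p∣≡0 =
  sym (p⊆q∧∣q∣≤∣p∣⇒p≡q (⊆-min p) (≤-reflexive (trans ∣p∣≡0 (sym (∣⊥∣≡0 n)))))

∣p∣≡1⇒p≡⁅x⁆ : ∀ {n} {p : Subset n} → ∣ p ∣ ≡ 1 → ∃ λ x → p ≡ ⁅ x ⁆
∣p∣≡1⇒p≡⁅x⁆ {n} {p} ∣p∣≡1 =
  x , sym (p⊆q∧∣q∣≤∣p∣⇒p≡q ⁅x⁆⊆p (≤-reflexive (trans ∣p∣≡1 (sym (∣⁅x⁆∣≡1 x)))))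
  where
  ∅⊂p : ∅ ⊂ p
  ∅⊂p = p⊆q∧∣p∣<∣q∣⇒p⊂q (⊆-min p) (≤-trans (s≤s (≤-reflexive (∣⊥∣≡0 n))) (≤-reflexive (sym ∣p∣≡1)))

  x : Fin n
  x = proj₁ (proj₂ ∅⊂p)

  ⁅x⁆⊆p : ⁅ x ⁆ ⊆ p
  ⁅x⁆⊆p y∈⁅x⁆ = subst (_∈ p) (sym (x∈⁅y⁆⇒x≡y x y∈⁅x⁆)) (proj₁ (proj₂ (proj₂ ∅⊂p)))

x∉p⇒∣p∪⁅x⁆∣≡1+∣p∣ : ∀ {n} {x : Fin n} {p : Subset n} → x ∉ p → ∣ p ∪ ⁅ x ⁆ ∣ ≡ suc ∣ p ∣
x∉p⇒∣p∪⁅x⁆∣≡1+∣p∣ {x = fzero}  {inside  ∷ p} x∉p = contradiction here x∉p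
x∉p⇒∣p∪⁅x⁆∣≡1+∣p∣ {x = fzero}  {outside ∷ p} _   = cong (suc ∘ ∣_∣) (∪-identityʳ p)
x∉p⇒∣p∪⁅x⁆∣≡1+∣p∣ {x = fsuc x} {inside  ∷ p} x∉p = cong suc (x∉p⇒∣p∪⁅x⁆∣≡1+∣p∣ (x∉p ∘ there))
x∉p⇒∣p∪⁅x⁆∣≡1+∣p∣ {x = fsuc x} {outside ∷ p} x∉p = x∉p⇒∣p∪⁅x⁆∣≡1+∣p∣ (x∉p ∘ there)

x∈p⇒1+∣p-x∣≡∣p∣ : ∀ {n} {x : Fin n} {p : Subset n} → x ∈ p → suc ∣ p - x ∣ ≡ ∣ p ∣
x∈p⇒1+∣p-x∣≡∣p∣ {x = fzero}  {inside  ∷ p} here        = cong (suc ∘ ∣_∣) (p─⊥≡p p)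
x∈p⇒1+∣p-x∣≡∣p∣ {x = fsuc x} {inside  ∷ p} (there x∈p) = cong suc (x∈p⇒1+∣p-x∣≡∣p∣ x∈p)
x∈p⇒1+∣p-x∣≡∣p∣ {x = fsuc x} {outside ∷ p} (there x∈p) = x∈p⇒1+∣p-x∣≡∣p∣ x∈p

x∉p-x : ∀ {n} {x : Fin n} {p : Subset n} → x ∉ p - x
x∉p-x {x = fzero}  {_ ∷ p} ()
x∉p-x {x = fsuc x} {_ ∷ p} (there x∈p-x) = x∉p-x x∈p-x

p⊆q∧x∈q⇒p∪⁅x⁆⊆q : ∀ {n} {x : Fin n} {p q : Subset n} → p ⊆ q → x ∈ q → p ∪ ⁅ x ⁆ ⊆ q
p⊆q∧x∈q⇒p∪⁅x⁆⊆q {x = x} {p} p⊆q x∈q y∈p∪⁅x⁆ with x∈p∪q⁻ p ⁅ x ⁆ y∈p∪⁅x⁆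
... | inj₁ y∈p   = p⊆q y∈p
... | inj₂ y∈⁅x⁆ = subst (_∈ _) (sym (x∈⁅y⁆⇒x≡y x y∈⁅x⁆)) x∈q

interval₂-cases : ∀ {n} {K J L : Subset n} {e : Fin n} → e ∈ L → e ∉ K →
                  ∣ L ∣ ≡ suc (suc ∣ K ∣) → K ⊆ J → J ⊆ L → ∣ J ∣ ≡ suc ∣ K ∣ →
                  J ≡ K ∪ ⁅ e ⁆ ⊎ J ≡ L - e
interval₂-cases {K = K} {J} {L} {e} e∈L e∉K ∣L∣≡2+∣K∣ K⊆J J⊆L ∣J∣≡1+∣K∣ with e ∈? J
... | yes e∈J = inj₁ (sym (p⊆q∧∣q∣≤∣p∣⇒p≡q (p⊆q∧x∈q⇒p∪⁅x⁆⊆q K⊆J e∈J) ∣J∣≤∣K∪⁅e⁆∣))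
  where
  ∣J∣≤∣K∪⁅e⁆∣ : ∣ J ∣ ≤ ∣ K ∪ ⁅ e ⁆ ∣
  ∣J∣≤∣K∪⁅e⁆∣ = ≤-reflexive (trans ∣J∣≡1+∣K∣ (sym (x∉p⇒∣p∪⁅x⁆∣≡1+∣p∣ e∉K)))
... | no e∉J = inj₂ (p⊆q∧∣q∣≤∣p∣⇒p≡q J⊆L-e ∣L-e∣≤∣J∣)
  where
  J⊆L-e : J ⊆ L - e
  J⊆L-e y∈J = x∈p∧x≢y⇒x∈p-y (J⊆L y∈J) λ { refl → e∉J y∈J }

  ∣L-e∣≤∣J∣ : ∣ L - e ∣ ≤ ∣ J ∣
  ∣L-e∣≤∣J∣ =
    ≤-reflexive (suc-injective (trans (x∈p⇒1+∣p-x∣≡∣p∣ e∈L) (trans ∣L∣≡2+∣K∣ (cong suc (sym ∣J∣≡1+∣K∣)))))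

module _ {p q : ℕ} (G : Graph p q) where

  τ-involutive : ∀ e → τ G e ∘ₚ τ G e ≈ id
  τ-involutive e = transpose-involutive _ _

  flip-τ : ∀ e → flip (τ G e) ≈ τ G e
  flip-τ e = transpose-comm _ _

  α≉τ∘ₚα : ∀ e (α : Permutation′ p) → ¬ (α ≈ τ G e ∘ₚ α)
  α≉τ∘ₚα e α α≈τα = loopless G e (Injection.injective (↔⇒↣ α) αu≡αv)
    where
    u v : Fin p
    u = proj₁ (ends G e)
    v = proj₂ (ends G e)

    αu≡αv : α ⟨$⟩ʳ u ≡ α ⟨$⟩ʳ v
    αu≡αv = trans (α≈τα u) (cong (α ⟨$⟩ʳ_) (transpose-matchˡ u v))

  InT-mono : ∀ {K L σ} → K ⊆ L → InT G K σ → InT G L σ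
  InT-mono K⊆L (gen e e∈K σ≈τ) = gen e (K⊆L e∈K) σ≈τ
  InT-mono K⊆L (one σ≈id)       = one σ≈id
  InT-mono K⊆L (mul s r σ≈)     = mul (InT-mono K⊆L s) (InT-mono K⊆L r) σ≈
  InT-mono K⊆L (inv s σ≈)       = inv (InT-mono K⊆L s) σ≈

  record SubgroupContaining (K : Subset q) (P : Permutation′ p → Set) : Set where
    field
      resp-≈      : ∀ {σ ρ} → σ ≈ ρ → P σ → P ρ
      has-id      : P id
      has-τ       : ∀ {e} → e ∈ K → P (τ G e)
      ∘ₚ-closed   : ∀ {σ ρ} → P σ → P ρ → P (σ ∘ₚ ρ)
      flip-closed : ∀ {σ} → P σ → P (flip σ)

  InT-minimal : ∀ {K P} → SubgroupContaining K P → ∀ {t} → InT G K t → P t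
  InT-minimal {K} {P} S = go
    where
    open SubgroupContaining S

    go : ∀ {t} → InT G K t → P t
    go (gen e e∈K t≈τ) = resp-≈ (sym ∘ t≈τ) (has-τ e∈K)
    go (one t≈id)      = resp-≈ (sym ∘ t≈id) has-id
    go (mul s r t≈sr)  = resp-≈ (sym ∘ t≈sr) (∘ₚ-closed (go s) (go r))
    go (inv s t≈s⁻¹)   = resp-≈ (sym ∘ t≈s⁻¹) (flip-closed (go s))

  InT-∅ : ∀ {t} → InT G ∅ t → t ≈ id
  InT-∅ = InT-minimal {P = _≈ id} record
    { resp-≈      = λ σ≈ρ σ≈id i → trans (sym (σ≈ρ i)) (σ≈id i)
    ; has-id      = λ _ → refl
    ; has-τ       = λ e∈∅ → contradiction e∈∅ ∉⊥
    ; ∘ₚ-closed   = λ {σ} {ρ} σ≈id ρ≈id i → trans (ρ≈id (σ ⟨$⟩ʳ i)) (σ≈id i)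
    ; flip-closed = λ {σ} → flip-cong {σ = σ} {id}
    }

  InT-⁅e⁆ : ∀ {e t} → InT G ⁅ e ⁆ t → t ≈ id ⊎ t ≈ τ G e
  InT-⁅e⁆ {e} = InT-minimal {P = λ t → t ≈ id ⊎ t ≈ τ G e} record
    { resp-≈      = λ σ≈ρ → Sum.map (λ σ≈id i → trans (sym (σ≈ρ i)) (σ≈id i))
                                    (λ σ≈τ i → trans (sym (σ≈ρ i)) (σ≈τ i))
    ; has-id      = inj₁ λ _ → refl
    ; has-τ       = λ e′∈⁅e⁆ → inj₂ λ i → cong (λ e′ → τ G e′ ⟨$⟩ʳ i) (x∈⁅y⁆⇒x≡y e e′∈⁅e⁆)
    ; ∘ₚ-closed   = λ {σ} {ρ} → ∘ₚ-closed {σ} {ρ}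
    ; flip-closed = λ {σ} → Sum.map (flip-cong {σ = σ} {id})
                                    (λ σ≈τ i → trans (flip-cong {σ = σ} {τ G e} σ≈τ i) (flip-τ e i))
    }
    where
    ∘ₚ-closed : ∀ {σ ρ} → σ ≈ id ⊎ σ ≈ τ G e → ρ ≈ id ⊎ ρ ≈ τ G e → σ ∘ₚ ρ ≈ id ⊎ σ ∘ₚ ρ ≈ τ G e
    ∘ₚ-closed (inj₁ σ≈id) (inj₁ ρ≈id) = inj₁ λ i → trans (ρ≈id _) (σ≈id i)
    ∘ₚ-closed (inj₁ σ≈id) (inj₂ ρ≈τ)  = inj₂ λ i → trans (ρ≈τ _) (cong (τ G e ⟨$⟩ʳ_) (σ≈id i))
    ∘ₚ-closed (inj₂ σ≈τ)  (inj₁ ρ≈id) = inj₂ λ i → trans (ρ≈id _) (σ≈τ i)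
    ∘ₚ-closed (inj₂ σ≈τ)  (inj₂ ρ≈τ)  =
      inj₁ λ i → trans (ρ≈τ _) (trans (cong (τ G e ⟨$⟩ʳ_) (σ≈τ i)) (τ-involutive e i))

  InCoset-≈ : ∀ K α σ → σ ≈ α → InCoset G K α σ
  InCoset-≈ K α σ σ≈α = id , one (λ _ → refl) , σ≈α

  InCoset-refl : ∀ K α → InCoset G K α α
  InCoset-refl K α = InCoset-≈ K α α (λ _ → refl)

  InCoset-mono : ∀ {K L} α σ → K ⊆ L → InCoset G K α σ → InCoset G L α σ
  InCoset-mono α σ K⊆L (t , t∈T , σ≈tα) = t , InT-mono K⊆L t∈T , σ≈tα

  InCoset-trans : ∀ {L} β α σ → InCoset G L β α → InCoset G L α σ → InCoset G L β σ
  InCoset-trans β α σ (s , s∈T , α≈sβ) (t , t∈T , σ≈tα) =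
    t ∘ₚ s , mul t∈T s∈T (λ _ → refl) , λ i → trans (σ≈tα i) (α≈sβ (t ⟨$⟩ʳ i))

  InCoset-sym : ∀ {L} γ α → InCoset G L γ α → InCoset G L α γ
  InCoset-sym γ α (s , s∈T , α≈sγ) =
    flip s , inv s∈T (λ _ → refl) ,
    λ i → trans (cong (γ ⟨$⟩ʳ_) (sym (inverseʳ s))) (sym (α≈sγ (s ⟨$⟩ˡ i)))

  InCoset-∅ : ∀ α σ → InCoset G ∅ α σ → σ ≈ α
  InCoset-∅ α σ (t , t∈T , σ≈tα) i = trans (σ≈tα i) (cong (α ⟨$⟩ʳ_) (InT-∅ t∈T i))

  InCoset-⁅e⁆ : ∀ {e} β γ → InCoset G ⁅ e ⁆ β γ → γ ≈ β ⊎ γ ≈ τ G e ∘ₚ β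
  InCoset-⁅e⁆ β γ (t , t∈T , γ≈tβ) with InT-⁅e⁆ t∈T
  ... | inj₁ t≈id = inj₁ λ i → trans (γ≈tβ i) (cong (β ⟨$⟩ʳ_) (t≈id i))
  ... | inj₂ t≈τ  = inj₂ λ i → trans (γ≈tβ i) (cong (β ⟨$⟩ʳ_) (t≈τ i))

  InCoset⇒∼ : ∀ {J} γ α → InCoset G J γ α → _∼_ G (J , γ) (J , α)
  InCoset⇒∼ γ α α∈Jγ = refl , λ σ →
    mk⇔ (InCoset-trans α γ σ (InCoset-sym γ α α∈Jγ)) (InCoset-trans γ α σ α∈Jγ)

  ≈⇒∼ : ∀ {J} γ α → γ ≈ α → _∼_ G (J , γ) (J , α)
  ≈⇒∼ {J} γ α γ≈α = InCoset⇒∼ γ α (InCoset-≈ J γ α (sym ∘ γ≈α))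

  ≤F⇒∼ : ∀ {K J} α γ → _≤F_ G (K , α) (J , γ) → _∼_ G (J , γ) (J , α)
  ≤F⇒∼ {K} α γ (_ , Kα⊆Jγ) = InCoset⇒∼ γ α (Kα⊆Jγ α (InCoset-refl K α))

  ≤F-through : ∀ {K J L} α β → K ⊆ J → J ⊆ L → _≤F_ G (K , α) (L , β) →
               _≤F_ G (K , α) (J , α) × _≤F_ G (J , α) (L , β)
  ≤F-through {K} α β K⊆J J⊆L (_ , Kα⊆Lβ) =
    (K⊆J , λ σ → InCoset-mono α σ K⊆J) ,
    (J⊆L , λ σ σ∈Jα → InCoset-trans β α σ (Kα⊆Lβ α (InCoset-refl K α)) (InCoset-mono α σ J⊆L σ∈Jα))

  ∅≤F : ∀ {L} β σ → InCoset G L β σ → _≤F_ G (∅ , σ) (L , β)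
  ∅≤F β σ σ∈Lβ = ⊆-min _ , λ ρ ρ∈∅σ → InCoset-trans β σ ρ σ∈Lβ (InCoset-mono σ ρ (⊆-min _) ρ∈∅σ)

  interval₂-diamond : ∀ {i} (F H : Face G) → suc (rank G F) ≡ i → rank G H ≡ suc i → _≤F_ G F H →
                      ExactlyTwo G (λ J → (rank G J ≡ i) × _≤F_ G F J × _≤F_ G J H)
  interval₂-diamond (K , α) (L , β) refl ∣L∣≡2+∣K∣ Kα≤Lβ@(K⊆L , _) =
    (K ∪ ⁅ e ⁆ , α) , (L - e , α) ,
    (x∉p⇒∣p∪⁅x⁆∣≡1+∣p∣ e∉K , ≤F-through α β (p⊆p∪q _) (p⊆q∧x∈q⇒p∪⁅x⁆⊆q K⊆L e∈L) Kα≤Lβ) ,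
    (suc-injective (trans (x∈p⇒1+∣p-x∣≡∣p∣ e∈L) ∣L∣≡2+∣K∣) , ≤F-through α β K⊆L-e (p─q⊆p L _) Kα≤Lβ) ,
    (λ (K∪e≡L-e , _) → x∉p-x (subst (e ∈_) K∪e≡L-e (x∈p∪q⁺ (inj₂ (x∈⁅x⁆ e))))) ,
    unique
    where
    K⊂L : K ⊂ L
    K⊂L = p⊆q∧∣p∣<∣q∣⇒p⊂q K⊆L (≤-trans (n≤1+n _) (≤-reflexive (sym ∣L∣≡2+∣K∣)))

    e : Fin q
    e = proj₁ (proj₂ K⊂L)

    e∈L : e ∈ L
    e∈L = proj₁ (proj₂ (proj₂ K⊂L))

    e∉K : e ∉ K
    e∉K = proj₂ (proj₂ (proj₂ K⊂L))

    K⊆L-e : K ⊆ L - e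
    K⊆L-e x∈K = x∈p∧x≢y⇒x∈p-y (K⊆L x∈K) λ { refl → e∉K x∈K }

    unique : ∀ J → (rank G J ≡ suc ∣ K ∣) × _≤F_ G (K , α) J × _≤F_ G J (L , β) →
             _∼_ G J (K ∪ ⁅ e ⁆ , α) ⊎ _∼_ G J (L - e , α)
    unique (J , γ) (∣J∣≡1+∣K∣ , Kα≤Jγ@(K⊆J , _) , (J⊆L , _))
      with interval₂-cases e∈L e∉K ∣L∣≡2+∣K∣ K⊆J J⊆L ∣J∣≡1+∣K∣
    ... | inj₁ refl = inj₁ (≤F⇒∼ α γ Kα≤Jγ)
    ... | inj₂ refl = inj₂ (≤F⇒∼ α γ Kα≤Jγ)

  edge-has-two-vertices : ∀ (H : Face G) → rank G H ≡ 1 →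
                          ExactlyTwo G (λ J → (rank G J ≡ 0) × _≤F_ G J H)
  edge-has-two-vertices (L , β) ∣L∣≡1 with ∣p∣≡1⇒p≡⁅x⁆ {p = L} ∣L∣≡1
  ... | e , refl =
    (∅ , β) , (∅ , τ G e ∘ₚ β) ,
    (∣⊥∣≡0 q , ∅≤F β β (InCoset-refl ⁅ e ⁆ β)) ,
    (∣⊥∣≡0 q , ∅≤F β (τ G e ∘ₚ β) τβ∈⁅e⁆β) ,
    (λ (_ , same-coset) → α≉τ∘ₚα e β (InCoset-∅ (τ G e ∘ₚ β) β
                                        (Equivalence.to (same-coset β) (InCoset-refl ∅ β)))) ,
    unique
    where
    τβ∈⁅e⁆β : InCoset G ⁅ e ⁆ β (τ G e ∘ₚ β)
    τβ∈⁅e⁆β = τ G e , gen e (x∈⁅x⁆ e) (λ _ → refl) , λ _ → refl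

    unique : ∀ J → (rank G J ≡ 0) × _≤F_ G J (⁅ e ⁆ , β) →
             _∼_ G J (∅ , β) ⊎ _∼_ G J (∅ , τ G e ∘ₚ β)
    unique (J , γ) (∣J∣≡0 , _ , Jγ⊆⁅e⁆β) with ∣p∣≡0⇒p≡∅ {p = J} ∣J∣≡0
    ... | refl with InCoset-⁅e⁆ β γ (Jγ⊆⁅e⁆β γ (InCoset-refl ∅ γ))
    ... | inj₁ γ≈β  = inj₁ (≈⇒∼ γ β γ≈β)
    ... | inj₂ γ≈τβ = inj₂ (≈⇒∼ γ (τ G e ∘ₚ β) γ≈τβ)

lemma7 : ∀ {p q : ℕ} (G : Graph p q) → Connected G →
  (∀ (i : ℕ) → 1 ≤ i → i < q →
    ∀ (F H : Face G) → suc (rank G F) ≡ i → rank G H ≡ suc i → _≤F_ G F H →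
    ExactlyTwo G (λ J → (rank G J ≡ i) × _≤F_ G F J × _≤F_ G J H))
  ×
  (∀ (H : Face G) → rank G H ≡ 1 →
    ExactlyTwo G (λ J → (rank G J ≡ 0) × _≤F_ G J H))
lemma7 G _ = (λ _ _ _ → interval₂-diamond G) , edge-has-two-vertices G
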